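{- Let $\mathcal G$ be the infinite directed graph with vertex set $\{T_i, B_i : i\ge 0\}$ and the following edges: $T_i\to B_i$ for all $i\ge0$; $B_i\to T_{i+1}$ for all $i\ge0$; $T_{i+1}\to T_i$ and $B_{i+1}\to B_i$ for all $i\ge0$; and additionally $T_j\to T_0$ and $B_j\to B_0$ for all $j\ge2$. For $i\ge0$ let $f_i(z)$ (resp. $g_i(z)$) be the generating function whose coefficient of $z^n$ is the number of directed walks with $n$ edges in $\mathcal G$ from $T_0$ to $T_i$ (resp. to $B_i$). Let $t=t(z)$ be the unique formal power series with $t(0)=0$ and $t(1-t)^2=z^3$. Then for every $k\ge0$, $$f_{k+1}=\frac{(z-t)(1-t)}{ -t+z-2zt+zt^2}\,\frac{t^{k+1}}{z^{k+1}},\qquad g_{k+1}=\frac{t(z-t)}{ -t+z-2zt+zt^2}\,\frac{t^{k}}{z^{k}}.$$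
   Context: Here $t/z$ is a formal power series in $z$ (since $t=z^3+O(z^6)$), so the right-hand sides are formal power series. Walks from $T_0$ in $\mathcal G$ encode (possibly open) $S$-Motzkin paths with catastrophes: flat and up steps alternate starting with flat (down steps interspersed), the path never goes below level $0$, and catastrophe steps go from any level $j\ge2$ directly to level $0$. -}

module Defs where

open import Data.Nat using (ℕ; zero; suc)
open import Data.Integer using (ℤ; +_; _+_; _*_; -_; _-_)
open import Data.Fin using (Fin)
open import Relation.Binary.PropositionalEquality using (_≡_)

data V : Set where
  T : ℕ → V
  B : ℕ → V

-- One constructor per edge of 𝒢 (no two constructors give the same pair).
data Edge : V → V → Set where
  tb : ∀ i → Edge (T i) (B i)
  bt : ∀ i → Edge (B i) (T (suc i))
  tt : ∀ i → Edge (T (suc i)) (T i)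
  bb : ∀ i → Edge (B (suc i)) (B i)
  tc : ∀ j → Edge (T (suc (suc j))) (T 0)
  bc : ∀ j → Edge (B (suc (suc j))) (B 0)

data Walk : ℕ → V → V → Set where
  []  : ∀ {v} → Walk 0 v v
  _∷_ : ∀ {n u w v} → Edge u w → Walk n w v → Walk (suc n) u v

FPS : Set
FPS = ℕ → ℤ

infix 4 _≐_
_≐_ : FPS → FPS → Set
a ≐ b = ∀ n → a n ≡ b n

infixl 6 _⊕_ _⊖_
infixl 7 _⊛_

_⊕_ : FPS → FPS → FPS
(a ⊕ b) n = a n + b n

_⊖_ : FPS → FPS → FPS
(a ⊖ b) n = a n - b n

const : ℤ → FPS
const c zero    = c
const c (suc n) = + 0

𝟙 : FPS
𝟙 = const (+ 1)

X : FPS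
X (suc zero) = + 1
X _          = + 0

Σ≤ : ℕ → (ℕ → ℤ) → ℤ
Σ≤ zero    h = h 0
Σ≤ (suc n) h = Σ≤ n h + h (suc n)

_⊛_ : FPS → FPS → FPS
(a ⊛ b) n = Σ≤ n (λ i → a i * b (n Data.Nat.∸ i))

infixr 8 _^^_
_^^_ : FPS → ℕ → FPS
a ^^ zero  = 𝟙
a ^^ suc k = a ⊛ (a ^^ k)

ser : (ℕ → ℕ) → FPS
ser c n = + (c n)

-- Splitting off the last edge, the numbers of walks from T₀ satisfy a recurrence in the length which
-- determines them (walkCount-unique).  Write t = X³s, so that s (1 - t)² = 1, and put q = t/X = X²s and
-- D = 1 - q - 2t + t², so that X D is the denominator of the theorem.  The series
--   g_i = W qⁱ,  f_{i+1} = A qⁱ,  f₀ = 1 + X A/(1 - q),  with W = (X - t)/D and A = X s (1 - t) W,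
-- satisfy the same recurrence: along the levels this reduces to two polynomial identities and the cubic,
-- and the catastrophe sums into T₀ and B₀ are geometric series in q, which is divisible by X.
-- Multiplying out f_{k+1} and g_{k+1} gives the closed forms.

module Submission where

open import Defs
open import Data.Nat as ℕ using (ℕ; zero; suc; _∸_; _≤_; _<_; z≤n; s≤s)
import Data.Nat.Properties as ℕP
open import Data.Integer using (ℤ; +_; -_; _+_; _*_; _-_)
import Data.Integer.Properties as ℤP
open import Data.Integer.Tactic.RingSolver using (solve-∀)
open import Data.Fin using (Fin)
open import Data.Fin.Properties using (+↔⊎)
open import Data.Fin.Permutation using (↔⇒≡)
open import Data.Product using (Σ; _×_; _,_; proj₁; proj₂)
open import Data.Sum using (_⊎_; inj₁; inj₂)
open import Data.Sum.Function.Propositional using (_⊎-↔_)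
open import Data.Empty using (⊥-elim)
open import Data.Maybe as Maybe using (Maybe)
open import Relation.Nullary using (¬_)
open import Relation.Nullary.Decidable using (dec⇒maybe)
open import Function using (_∘_)
open import Function.Bundles using (_↔_; mk↔ₛ′)
open import Function.Properties.Inverse using (↔-trans; ↔-sym)
open import Relation.Binary.PropositionalEquality
open import Algebra.Bundles using (CommutativeRing)
open import Algebra.Structures using (IsCommutativeRing)
import Algebra.Construct.Pointwise as Pointwise
import Algebra.Solver.Ring.AlmostCommutativeRing as ACR
import Relation.Binary.Reasoning.Setoid as SetoidReasoning

Σ≤-cong : ∀ n {h k : ℕ → ℤ} → (∀ i → i ≤ n → h i ≡ k i) → Σ≤ n h ≡ Σ≤ n k
Σ≤-cong zero    h≡k = h≡k 0 z≤n
Σ≤-cong (suc n) h≡k =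
  cong₂ _+_ (Σ≤-cong n (λ i i≤n → h≡k i (ℕP.m≤n⇒m≤1+n i≤n))) (h≡k (suc n) ℕP.≤-refl)

Σ≤-cong′ : ∀ n {h k : ℕ → ℤ} → (∀ i → h i ≡ k i) → Σ≤ n h ≡ Σ≤ n k
Σ≤-cong′ n h≡k = Σ≤-cong n (λ i _ → h≡k i)

Σ≤-suc : ∀ n h → Σ≤ (suc n) h ≡ h 0 + Σ≤ n (h ∘ suc)
Σ≤-suc zero    h = refl
Σ≤-suc (suc n) h = trans (cong (_+ h (suc (suc n))) (Σ≤-suc n h)) (ℤP.+-assoc (h 0) _ _)

Σ≤-+ : ∀ n h k → Σ≤ n (λ i → h i + k i) ≡ Σ≤ n h + Σ≤ n k
Σ≤-+ zero    h k = refl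
Σ≤-+ (suc n) h k = trans (cong (_+ (h (suc n) + k (suc n))) (Σ≤-+ n h k))
                         (+-interchange (Σ≤ n h) (Σ≤ n k) (h (suc n)) (k (suc n)))
  where
  +-interchange : ∀ a b c d → (a + b) + (c + d) ≡ (a + c) + (b + d)
  +-interchange = solve-∀

Σ≤-*ˡ : ∀ n c h → Σ≤ n (λ i → c * h i) ≡ c * Σ≤ n h
Σ≤-*ˡ zero    c h = refl
Σ≤-*ˡ (suc n) c h = trans (cong (_+ c * h (suc n)) (Σ≤-*ˡ n c h)) (sym (ℤP.*-distribˡ-+ c _ _))

Σ≤-zero : ∀ n h → (∀ i → h i ≡ + 0) → Σ≤ n h ≡ + 0
Σ≤-zero zero    h h≡0 = h≡0 0
Σ≤-zero (suc n) h h≡0 = cong₂ _+_ (Σ≤-zero n h h≡0) (h≡0 (suc n))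

Σ≤-reverse : ∀ n h → Σ≤ n h ≡ Σ≤ n (λ i → h (n ∸ i))
Σ≤-reverse zero    h = refl
Σ≤-reverse (suc n) h = begin
  Σ≤ n h + h (suc n)                   ≡⟨ ℤP.+-comm (Σ≤ n h) (h (suc n)) ⟩
  h (suc n) + Σ≤ n h                   ≡⟨ cong (_+_ (h (suc n))) (Σ≤-reverse n h) ⟩
  h (suc n) + Σ≤ n (λ i → h (n ∸ i))   ≡⟨ sym (Σ≤-suc n (λ i → h (suc n ∸ i))) ⟩
  Σ≤ (suc n) (λ i → h (suc n ∸ i))     ∎
  where open ≡-Reasoning

-- The ring of formal power series

shift : FPS → FPS
shift a n = a (suc n)

infixr 7 _·_
_·_ : ℤ → FPS → FPS
(c · a) n = c * a n

⊛-suc : ∀ a b n → (a ⊛ b) (suc n) ≡ a 0 * b (suc n) + (shift a ⊛ b) n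
⊛-suc a b n = Σ≤-suc n (λ i → a i * b (suc n ∸ i))

⊛-cong : ∀ {a a′ b b′} → a ≐ a′ → b ≐ b′ → a ⊛ b ≐ a′ ⊛ b′
⊛-cong a≐a′ b≐b′ n = Σ≤-cong′ n (λ i → cong₂ _*_ (a≐a′ i) (b≐b′ (n ∸ i)))

≐-refl : ∀ {a} → a ≐ a
≐-refl n = refl

≐-sym : ∀ {a b} → a ≐ b → b ≐ a
≐-sym a≐b n = sym (a≐b n)

≐-trans : ∀ {a b c} → a ≐ b → b ≐ c → a ≐ c
≐-trans a≐b b≐c n = trans (a≐b n) (b≐c n)

⊕-cong : ∀ {a a′ b b′} → a ≐ a′ → b ≐ b′ → a ⊕ b ≐ a′ ⊕ b′
⊕-cong a≐a′ b≐b′ n = cong₂ _+_ (a≐a′ n) (b≐b′ n)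

⊖-cong : ∀ {a a′ b b′} → a ≐ a′ → b ≐ b′ → a ⊖ b ≐ a′ ⊖ b′
⊖-cong a≐a′ b≐b′ n = cong₂ _-_ (a≐a′ n) (b≐b′ n)

⊕-congˡ : ∀ a {b b′} → b ≐ b′ → a ⊕ b ≐ a ⊕ b′
⊕-congˡ a = ⊕-cong {a} ≐-refl

⊕-congʳ : ∀ {a a′} b → a ≐ a′ → a ⊕ b ≐ a′ ⊕ b
⊕-congʳ b a≐a′ = ⊕-cong {b = b} a≐a′ ≐-refl

⊖-congˡ : ∀ a {b b′} → b ≐ b′ → a ⊖ b ≐ a ⊖ b′
⊖-congˡ a = ⊖-cong {a} ≐-refl

⊛-congˡ : ∀ a {b b′} → b ≐ b′ → a ⊛ b ≐ a ⊛ b′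
⊛-congˡ a = ⊛-cong {a} ≐-refl

⊛-congʳ : ∀ {a a′} b → a ≐ a′ → a ⊛ b ≐ a′ ⊛ b
⊛-congʳ b a≐a′ = ⊛-cong {b = b} a≐a′ ≐-refl

^^-cong : ∀ {a b} k → a ≐ b → a ^^ k ≐ b ^^ k
^^-cong zero    a≐b = ≐-refl
^^-cong (suc k) a≐b = ⊛-cong a≐b (^^-cong k a≐b)

⊛-comm : ∀ a b → a ⊛ b ≐ b ⊛ a
⊛-comm a b n = trans (Σ≤-reverse n _) (Σ≤-cong n λ i i≤n →
  trans (ℤP.*-comm (a (n ∸ i)) (b (n ∸ (n ∸ i))))
        (cong (λ j → b j * a (n ∸ i)) (ℕP.m∸[m∸n]≡n i≤n)))

⊛-distribˡ : ∀ a b c → a ⊛ (b ⊕ c) ≐ a ⊛ b ⊕ a ⊛ c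
⊛-distribˡ a b c n =
  trans (Σ≤-cong′ n (λ i → ℤP.*-distribˡ-+ (a i) (b (n ∸ i)) (c (n ∸ i)))) (Σ≤-+ n _ _)

⊛-distribʳ : ∀ a b c → (b ⊕ c) ⊛ a ≐ b ⊛ a ⊕ c ⊛ a
⊛-distribʳ a b c n =
  trans (Σ≤-cong′ n (λ i → ℤP.*-distribʳ-+ (a (n ∸ i)) (b i) (c i))) (Σ≤-+ n _ _)

·-⊛ : ∀ c a b → (c · a) ⊛ b ≐ c · (a ⊛ b)
·-⊛ c a b n = trans (Σ≤-cong′ n (λ i → ℤP.*-assoc c (a i) (b (n ∸ i)))) (Σ≤-*ˡ n c _)

⊛-assoc : ∀ a b c → (a ⊛ b) ⊛ c ≐ a ⊛ (b ⊛ c)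
⊛-assoc a b c zero    = ℤP.*-assoc (a 0) (b 0) (c 0)
⊛-assoc a b c (suc n) = begin
  ((a ⊛ b) ⊛ c) (suc n)
    ≡⟨ ⊛-suc (a ⊛ b) c n ⟩
  (a 0 * b 0) * c (suc n) + (shift (a ⊛ b) ⊛ c) n
    ≡⟨ cong (_+_ ((a 0 * b 0) * c (suc n))) shifted ⟩
  (a 0 * b 0) * c (suc n) + (a 0 * (shift b ⊛ c) n + (shift a ⊛ (b ⊛ c)) n)
    ≡⟨ regroup (a 0) (b 0) (c (suc n)) ((shift b ⊛ c) n) ((shift a ⊛ (b ⊛ c)) n) ⟩
  a 0 * (b 0 * c (suc n) + (shift b ⊛ c) n) + (shift a ⊛ (b ⊛ c)) n
    ≡⟨ cong (λ x → a 0 * x + (shift a ⊛ (b ⊛ c)) n) (sym (⊛-suc b c n)) ⟩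
  a 0 * (b ⊛ c) (suc n) + (shift a ⊛ (b ⊛ c)) n
    ≡⟨ sym (⊛-suc a (b ⊛ c) n) ⟩
  (a ⊛ (b ⊛ c)) (suc n) ∎
  where
  open ≡-Reasoning
  regroup : ∀ a₀ b₀ c₁ y z → (a₀ * b₀) * c₁ + (a₀ * y + z) ≡ a₀ * (b₀ * c₁ + y) + z
  regroup = solve-∀
  shifted : (shift (a ⊛ b) ⊛ c) n ≡ a 0 * (shift b ⊛ c) n + (shift a ⊛ (b ⊛ c)) n
  shifted = begin
    (shift (a ⊛ b) ⊛ c) n
      ≡⟨ ⊛-congʳ c (⊛-suc a b) n ⟩
    ((a 0 · shift b ⊕ shift a ⊛ b) ⊛ c) n
      ≡⟨ ⊛-distribʳ c (a 0 · shift b) (shift a ⊛ b) n ⟩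
    ((a 0 · shift b) ⊛ c) n + ((shift a ⊛ b) ⊛ c) n
      ≡⟨ cong₂ _+_ (·-⊛ (a 0) (shift b) c n) (⊛-assoc (shift a) b c n) ⟩
    a 0 * (shift b ⊛ c) n + (shift a ⊛ (b ⊛ c)) n
      ∎

⊛-identityˡ : ∀ a → 𝟙 ⊛ a ≐ a
⊛-identityˡ a zero    = ℤP.*-identityˡ (a 0)
⊛-identityˡ a (suc n) = begin
  (𝟙 ⊛ a) (suc n)                    ≡⟨ ⊛-suc 𝟙 a n ⟩
  + 1 * a (suc n) + (shift 𝟙 ⊛ a) n  ≡⟨ cong₂ _+_ (ℤP.*-identityˡ (a (suc n)))
                                                  (Σ≤-zero n _ (λ i → ℤP.*-zeroˡ (a (n ∸ i)))) ⟩
  a (suc n) + + 0                    ≡⟨ ℤP.+-identityʳ (a (suc n)) ⟩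
  a (suc n)                          ∎
  where open ≡-Reasoning

⊛-identityʳ : ∀ a → a ⊛ 𝟙 ≐ a
⊛-identityʳ a n = trans (⊛-comm a 𝟙 n) (⊛-identityˡ a n)

fps-isCommutativeRing : IsCommutativeRing _≐_ _⊕_ _⊛_ (λ a n → - a n) (λ _ → + 0) 𝟙
fps-isCommutativeRing = record
  { isRing = record
    { +-isAbelianGroup = Pointwise.isAbelianGroup ℕ ℤP.+-0-isAbelianGroup
    ; *-cong           = ⊛-cong
    ; *-assoc          = ⊛-assoc
    ; *-identity       = ⊛-identityˡ , ⊛-identityʳ
    ; distrib          = ⊛-distribˡ , ⊛-distribʳ
    }
  ; *-comm = ⊛-comm
  }

fps-commutativeRing : CommutativeRing _ _
fps-commutativeRing = record { isCommutativeRing = fps-isCommutativeRing }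

const-+ : ∀ a b → const (a + b) ≐ const a ⊕ const b
const-+ a b zero    = refl
const-+ a b (suc n) = refl

const-* : ∀ a b → const (a * b) ≐ const a ⊛ const b
const-* a b zero    = refl
const-* a b (suc n) = sym (begin
  (const a ⊛ const b) (suc n)                    ≡⟨ ⊛-suc (const a) (const b) n ⟩
  a * + 0 + (shift (const a) ⊛ const b) n        ≡⟨ cong₂ _+_ (ℤP.*-zeroʳ a)
                                                              (Σ≤-zero n _ (λ i → ℤP.*-zeroˡ (const b (n ∸ i)))) ⟩
  + 0                                            ∎)
  where open ≡-Reasoning

const-neg : ∀ a → const (- a) ≐ (λ n → - const a n)
const-neg a zero    = refl
const-neg a (suc n) = refl

const-zero : const (+ 0) ≐ (λ _ → + 0)
const-zero zero    = refl
const-zero (suc n) = refl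

const-homomorphism : CommutativeRing.rawRing ℤP.+-*-commutativeRing
                       ACR.-Raw-AlmostCommutative⟶ ACR.fromCommutativeRing fps-commutativeRing
const-homomorphism = record
  { ⟦_⟧    = const
  ; +-homo = const-+
  ; *-homo = const-*
  ; -‿homo = const-neg
  ; 0-homo = const-zero
  ; 1-homo = λ _ → refl
  }

const-≟ : ∀ a b → Maybe (const a ≐ const b)
const-≟ a b = Maybe.map (λ a≡b n → cong (λ c → const c n) a≡b) (dec⇒maybe (a ℤP.≟ b))

open import Algebra.Solver.Ring _ _ const-homomorphism const-≟
  using (solve; _:=_; _:+_; _:*_; _:-_; con)

module ≐-Reasoning = SetoidReasoning (CommutativeRing.setoid fps-commutativeRing)

^^-⊛-distrib : ∀ a b k → (a ⊛ b) ^^ k ≐ a ^^ k ⊛ b ^^ k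
^^-⊛-distrib a b zero    = ≐-sym (⊛-identityˡ 𝟙)
^^-⊛-distrib a b (suc k) = begin
  (a ⊛ b) ⊛ (a ⊛ b) ^^ k       ≈⟨ ⊛-congˡ (a ⊛ b) (^^-⊛-distrib a b k) ⟩
  (a ⊛ b) ⊛ (a ^^ k ⊛ b ^^ k)  ≈⟨ solve 4 (λ a b aᵏ bᵏ → (a :* b) :* (aᵏ :* bᵏ) := (a :* aᵏ) :* (b :* bᵏ))
                                          (λ _ → refl) a b (a ^^ k) (b ^^ k) ⟩
  (a ⊛ a ^^ k) ⊛ (b ⊛ b ^^ k)  ∎
  where open ≐-Reasoning

⊛-cancelˡ : ∀ {c d a b} → c ⊛ d ≐ 𝟙 → d ⊛ a ≐ d ⊛ b → a ≐ b
⊛-cancelˡ {c} {d} {a} {b} cd≐𝟙 da≐db = begin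
  a            ≈⟨ ≐-sym (⊛-identityˡ a) ⟩
  𝟙 ⊛ a        ≈⟨ ⊛-congʳ a (≐-sym cd≐𝟙) ⟩
  c ⊛ d ⊛ a    ≈⟨ ⊛-assoc c d a ⟩
  c ⊛ (d ⊛ a)  ≈⟨ ⊛-congˡ c da≐db ⟩
  c ⊛ (d ⊛ b)  ≈⟨ ≐-sym (⊛-assoc c d b) ⟩
  c ⊛ d ⊛ b    ≈⟨ ⊛-congʳ b cd≐𝟙 ⟩
  𝟙 ⊛ b        ≈⟨ ⊛-identityˡ b ⟩
  b            ∎
  where open ≐-Reasoning

X⊛-zero : ∀ a → (X ⊛ a) 0 ≡ + 0
X⊛-zero a = ℤP.*-zeroˡ (a 0)

X⊛-suc : ∀ a n → (X ⊛ a) (suc n) ≡ a n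
X⊛-suc a n = begin
  (X ⊛ a) (suc n)                    ≡⟨ ⊛-suc X a n ⟩
  + 0 * a (suc n) + (shift X ⊛ a) n  ≡⟨ cong₂ _+_ (ℤP.*-zeroˡ (a (suc n))) (⊛-congʳ a shift-X n) ⟩
  + 0 + (𝟙 ⊛ a) n                    ≡⟨ ℤP.+-identityˡ _ ⟩
  (𝟙 ⊛ a) n                          ≡⟨ ⊛-identityˡ a n ⟩
  a n                                ∎
  where
  open ≡-Reasoning
  shift-X : shift X ≐ 𝟙
  shift-X zero    = refl
  shift-X (suc n) = refl

X⊛-cancel : ∀ {a b} → X ⊛ a ≐ X ⊛ b → a ≐ b
X⊛-cancel {a} {b} Xa≐Xb n = trans (sym (X⊛-suc a n)) (trans (Xa≐Xb (suc n)) (X⊛-suc b n))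

X⊛-shift : ∀ a → a 0 ≡ + 0 → a ≐ X ⊛ shift a
X⊛-shift a a₀≡0 zero    = trans a₀≡0 (sym (X⊛-zero (shift a)))
X⊛-shift a a₀≡0 (suc n) = sym (X⊛-suc (shift a) n)

shiftⁿ : ℕ → FPS → FPS
shiftⁿ zero    a = a
shiftⁿ (suc k) a = shiftⁿ k (shift a)

X^^-factor : ∀ m → m 0 ≡ + 1 → ∀ k a → a ⊛ m ≐ X ^^ k →
             (a ≐ X ^^ k ⊛ shiftⁿ k a) × (shiftⁿ k a ⊛ m ≐ 𝟙)
X^^-factor m m₀≡1 zero    a am≐𝟙 = ≐-sym (⊛-identityˡ a) , am≐𝟙
X^^-factor m m₀≡1 (suc k) a am≐Xᵏ⁺¹ = a≐Xᵏ⁺¹⊛ , proj₂ factor-shift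
  where
  a₀≡0 : a 0 ≡ + 0
  a₀≡0 = begin
    a 0               ≡⟨ sym (ℤP.*-identityʳ (a 0)) ⟩
    a 0 * + 1         ≡⟨ cong (_*_ (a 0)) (sym m₀≡1) ⟩
    (a ⊛ m) 0         ≡⟨ am≐Xᵏ⁺¹ 0 ⟩
    (X ⊛ X ^^ k) 0    ≡⟨ X⊛-zero (X ^^ k) ⟩
    + 0               ∎
    where open ≡-Reasoning
  a≐X⊛shift-a : a ≐ X ⊛ shift a
  a≐X⊛shift-a = X⊛-shift a a₀≡0
  factor-shift : (shift a ≐ X ^^ k ⊛ shiftⁿ k (shift a)) × (shiftⁿ k (shift a) ⊛ m ≐ 𝟙)
  factor-shift = X^^-factor m m₀≡1 k (shift a) (X⊛-cancel (begin
    X ⊛ (shift a ⊛ m)  ≈⟨ ≐-sym (⊛-assoc X (shift a) m) ⟩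
    X ⊛ shift a ⊛ m    ≈⟨ ⊛-congʳ m (≐-sym a≐X⊛shift-a) ⟩
    a ⊛ m              ≈⟨ am≐Xᵏ⁺¹ ⟩
    X ⊛ X ^^ k         ∎))
    where open ≐-Reasoning
  a≐Xᵏ⁺¹⊛ : a ≐ X ^^ suc k ⊛ shiftⁿ (suc k) a
  a≐Xᵏ⁺¹⊛ = begin
    a                                       ≈⟨ a≐X⊛shift-a ⟩
    X ⊛ shift a                             ≈⟨ ⊛-congˡ X (proj₁ factor-shift) ⟩
    X ⊛ (X ^^ k ⊛ shiftⁿ k (shift a))       ≈⟨ ≐-sym (⊛-assoc X (X ^^ k) (shiftⁿ k (shift a))) ⟩
    X ^^ suc k ⊛ shiftⁿ (suc k) a           ∎
    where open ≐-Reasoning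

-- The coefficients of 1/a, computed with fuel: correct up to index fuel, + 0 is a junk value.
invᶠ : ℕ → FPS → FPS
invᶠ fuel       a zero    = + 1
invᶠ zero       a (suc n) = + 0
invᶠ (suc fuel) a (suc n) = - Σ≤ n (λ i → a (suc i) * invᶠ fuel a (n ∸ i))

invᶠ-fuel : ∀ a {f g} m → m ≤ f → m ≤ g → invᶠ f a m ≡ invᶠ g a m
invᶠ-fuel a                 zero    _         _         = refl
invᶠ-fuel a {suc f} {suc g} (suc n) (s≤s n≤f) (s≤s n≤g) = cong -_ (Σ≤-cong′ n (λ i →
  cong (_*_ (a (suc i)))
       (invᶠ-fuel a (n ∸ i) (ℕP.≤-trans (ℕP.m∸n≤m n i) n≤f) (ℕP.≤-trans (ℕP.m∸n≤m n i) n≤g))))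

inv : FPS → FPS
inv a n = invᶠ n a n

inv-suc : ∀ a n → inv a (suc n) ≡ - (shift a ⊛ inv a) n
inv-suc a n = cong -_ (Σ≤-cong′ n (λ i →
  cong (_*_ (a (suc i))) (invᶠ-fuel a (n ∸ i) (ℕP.m∸n≤m n i) ℕP.≤-refl)))

inv-inverseˡ : ∀ a → a 0 ≡ + 1 → inv a ⊛ a ≐ 𝟙
inv-inverseˡ a a₀≡1 n = trans (⊛-comm (inv a) a n) (a⊛inv n)
  where
  a⊛inv : a ⊛ inv a ≐ 𝟙
  a⊛inv zero    = cong (_* + 1) a₀≡1
  a⊛inv (suc n) = begin
    (a ⊛ inv a) (suc n)        ≡⟨ ⊛-suc a (inv a) n ⟩
    a 0 * inv a (suc n) + c    ≡⟨ cong₂ (λ x y → x * y + c) a₀≡1 (inv-suc a n) ⟩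
    + 1 * - c + c              ≡⟨ cong (_+ c) (ℤP.*-identityˡ (- c)) ⟩
    - c + c                    ≡⟨ ℤP.+-inverseˡ c ⟩
    + 0                        ∎
    where
    open ≡-Reasoning
    c : ℤ
    c = (shift a ⊛ inv a) n

⊛-^^-vanishes : ∀ {q p} → q ≐ X ⊛ p → ∀ k b n → n < k → (b ⊛ q ^^ k) n ≡ + 0
⊛-^^-vanishes {q} {p} q≐Xp (suc k) b n (s≤s n≤k) = trans (b⊛qᵏ⁺¹≐X⊛ n) (below n n≤k)
  where
  b⊛qᵏ⁺¹≐X⊛ : b ⊛ q ^^ suc k ≐ X ⊛ ((b ⊛ p) ⊛ q ^^ k)
  b⊛qᵏ⁺¹≐X⊛ = begin
    b ⊛ (q ⊛ q ^^ k)        ≈⟨ ⊛-congˡ b (⊛-congʳ (q ^^ k) q≐Xp) ⟩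
    b ⊛ (X ⊛ p ⊛ q ^^ k)    ≈⟨ solve 4 (λ b x p qᵏ → b :* (x :* p :* qᵏ) := x :* ((b :* p) :* qᵏ))
                                       (λ _ → refl) b X p (q ^^ k) ⟩
    X ⊛ ((b ⊛ p) ⊛ q ^^ k)  ∎
    where open ≐-Reasoning
  below : ∀ n → n ≤ k → (X ⊛ ((b ⊛ p) ⊛ q ^^ k)) n ≡ + 0
  below zero    _   = X⊛-zero ((b ⊛ p) ⊛ q ^^ k)
  below (suc n) n<k = trans (X⊛-suc ((b ⊛ p) ⊛ q ^^ k) n)
                            (⊛-^^-vanishes {p = p} q≐Xp k (b ⊛ p) n n<k)

⊛-geometric-step : ∀ {q r} → r ⊛ (𝟙 ⊖ q) ≐ 𝟙 → ∀ c → c ⊛ r ≐ c ⊕ c ⊛ q ⊛ r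
⊛-geometric-step {q} {r} r-inv c = begin
  c ⊛ r
    ≈⟨ solve 3 (λ c r q → c :* r := c :* (r :* (con (+ 1) :- q)) :+ c :* q :* r) (λ _ → refl) c r q ⟩
  c ⊛ (r ⊛ (𝟙 ⊖ q)) ⊕ c ⊛ q ⊛ r
    ≈⟨ ⊕-congʳ (c ⊛ q ⊛ r) (≐-trans (⊛-congˡ c r-inv) (⊛-identityʳ c)) ⟩
  c ⊕ c ⊛ q ⊛ r
    ∎
  where open ≐-Reasoning

⊛-geometric : ∀ {q p r} → q ≐ X ⊛ p → r ⊛ (𝟙 ⊖ q) ≐ 𝟙 →
              ∀ b n → (b ⊛ r) n ≡ Σ≤ n (λ j → (b ⊛ q ^^ j) n)
⊛-geometric {q} {p} {r} q≐Xp r-inv b n = begin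
  (b ⊛ r) n                            ≡⟨ partial n ⟩
  partialSum n + (b ⊛ q ^^ suc n ⊛ r) n  ≡⟨ cong (_+_ (partialSum n)) remainder≡0 ⟩
  partialSum n + + 0                   ≡⟨ ℤP.+-identityʳ (partialSum n) ⟩
  partialSum n                         ∎
  where
  open ≡-Reasoning
  partialSum : ℕ → ℤ
  partialSum N = Σ≤ N (λ j → (b ⊛ q ^^ j) n)
  partial : ∀ N → (b ⊛ r) n ≡ partialSum N + (b ⊛ q ^^ suc N ⊛ r) n
  partial zero    = trans (⊛-geometric-step {q} {r} r-inv b n)
    (cong₂ _+_ (sym (⊛-identityʳ b n)) (⊛-congʳ r (⊛-congˡ b (≐-sym (⊛-identityʳ q))) n))
  partial (suc N) = begin
    (b ⊛ r) n
      ≡⟨ partial N ⟩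
    partialSum N + (b ⊛ q ^^ suc N ⊛ r) n
      ≡⟨ cong (_+_ (partialSum N)) (⊛-geometric-step {q} {r} r-inv (b ⊛ q ^^ suc N) n) ⟩
    partialSum N + ((b ⊛ q ^^ suc N) n + (b ⊛ q ^^ suc N ⊛ q ⊛ r) n)
      ≡⟨ sym (ℤP.+-assoc (partialSum N) _ _) ⟩
    partialSum (suc N) + (b ⊛ q ^^ suc N ⊛ q ⊛ r) n
      ≡⟨ cong (_+_ (partialSum (suc N)))
              (⊛-congʳ r (solve 3 (λ b qᴺ q → b :* qᴺ :* q := b :* (q :* qᴺ)) (λ _ → refl) b (q ^^ suc N) q) n) ⟩
    partialSum (suc N) + (b ⊛ q ^^ suc (suc N) ⊛ r) n
      ∎
  remainder≡0 : (b ⊛ q ^^ suc n ⊛ r) n ≡ + 0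
  remainder≡0 = trans (solve 3 (λ b qⁿ r → b :* qⁿ :* r := (b :* r) :* qⁿ) (λ _ → refl) b (q ^^ suc n) r n)
                      (⊛-^^-vanishes {p = p} q≐Xp (suc n) (b ⊛ r) n ℕP.≤-refl)

-- Walks in 𝒢 and their numbers

level : V → ℕ
level (T i) = i
level (B i) = i

edge-level : ∀ {u w} → Edge u w → level w ≤ suc (level u)
edge-level (tb i) = ℕP.n≤1+n i
edge-level (bt i) = ℕP.≤-refl
edge-level (tt i) = ℕP.m≤n⇒m≤1+n (ℕP.n≤1+n i)
edge-level (bb i) = ℕP.m≤n⇒m≤1+n (ℕP.n≤1+n i)
edge-level (tc j) = z≤n
edge-level (bc j) = z≤n

walk-level : ∀ {n u v} → Walk n u v → level v ≤ level u ℕ.+ n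
walk-level {u = u} []            = ℕP.m≤m+n (level u) 0
walk-level {suc n} {u} {v} (_∷_ {w = w} e p) = begin
  level v                 ≤⟨ walk-level p ⟩
  level w ℕ.+ n           ≤⟨ ℕP.+-monoˡ-≤ n (edge-level e) ⟩
  suc (level u) ℕ.+ n     ≡⟨ sym (ℕP.+-suc (level u) n) ⟩
  level u ℕ.+ suc n       ∎
  where open ℕP.≤-Reasoning

_▷_ : ∀ {n u w v} → Walk n u w → Edge w v → Walk (suc n) u v
[]      ▷ e = e ∷ []
(d ∷ p) ▷ e = d ∷ (p ▷ e)

LastEdge : ℕ → V → V → Set
LastEdge n u v = Σ V (λ w → Walk n u w × Edge w v)

unsnoc : ∀ {n u v} → Walk (suc n) u v → LastEdge n u v
unsnoc {zero}  (e ∷ []) = _ , [] , e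
unsnoc {suc n} (d ∷ p) with unsnoc p
... | w , p′ , e = w , d ∷ p′ , e

unsnoc-▷ : ∀ {n u w v} (p : Walk n u w) (e : Edge w v) → unsnoc (p ▷ e) ≡ (w , p , e)
unsnoc-▷ []      e = refl
unsnoc-▷ (d ∷ p) e rewrite unsnoc-▷ p e = refl

▷-unsnoc : ∀ {n u v} (p : Walk (suc n) u v) → let (_ , p′ , e) = unsnoc p in p′ ▷ e ≡ p
▷-unsnoc {zero}  (e ∷ []) = refl
▷-unsnoc {suc n} (d ∷ p) with unsnoc p | ▷-unsnoc p
... | w , p′ , e | p′▷e≡p = cong (d ∷_) p′▷e≡p

walk-suc-↔ : ∀ {n u v} → Walk (suc n) u v ↔ LastEdge n u v
walk-suc-↔ = mk↔ₛ′ unsnoc (λ (_ , p , e) → p ▷ e) (λ (_ , p , e) → unsnoc-▷ p e) ▷-unsnoc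

module _ {n : ℕ} {u : V} where

  last-into-T₀ : LastEdge n u (T 0) ↔ Σ ℕ (λ j → Walk n u (T (suc j)))
  last-into-T₀ = mk↔ₛ′
    (λ { (_ , p , tt _) → 0 , p ; (_ , p , tc j) → suc j , p })
    (λ { (zero , p) → _ , p , tt 0 ; (suc j , p) → _ , p , tc j })
    (λ { (zero , p) → refl ; (suc j , p) → refl })
    (λ { (_ , p , tt _) → refl ; (_ , p , tc j) → refl })

  last-into-T : ∀ i → LastEdge n u (T (suc i)) ↔ (Walk n u (B i) ⊎ Walk n u (T (suc (suc i))))
  last-into-T i = mk↔ₛ′
    (λ { (_ , p , bt _) → inj₁ p ; (_ , p , tt _) → inj₂ p })
    (λ { (inj₁ p) → _ , p , bt i ; (inj₂ p) → _ , p , tt (suc i) })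
    (λ { (inj₁ p) → refl ; (inj₂ p) → refl })
    (λ { (_ , p , bt _) → refl ; (_ , p , tt _) → refl })

  last-into-B₀ : LastEdge n u (B 0) ↔ (Walk n u (T 0) ⊎ Σ ℕ (λ j → Walk n u (B (suc j))))
  last-into-B₀ = mk↔ₛ′
    (λ { (_ , p , tb _) → inj₁ p ; (_ , p , bb _) → inj₂ (0 , p) ; (_ , p , bc j) → inj₂ (suc j , p) })
    (λ { (inj₁ p) → _ , p , tb 0 ; (inj₂ (zero , p)) → _ , p , bb 0 ; (inj₂ (suc j , p)) → _ , p , bc j })
    (λ { (inj₁ p) → refl ; (inj₂ (zero , p)) → refl ; (inj₂ (suc j , p)) → refl })
    (λ { (_ , p , tb _) → refl ; (_ , p , bb _) → refl ; (_ , p , bc j) → refl })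

  last-into-B : ∀ i → LastEdge n u (B (suc i)) ↔ (Walk n u (T (suc i)) ⊎ Walk n u (B (suc (suc i))))
  last-into-B i = mk↔ₛ′
    (λ { (_ , p , tb _) → inj₁ p ; (_ , p , bb _) → inj₂ p })
    (λ { (inj₁ p) → _ , p , tb (suc i) ; (inj₂ p) → _ , p , bb (suc i) })
    (λ { (inj₁ p) → refl ; (inj₂ p) → refl })
    (λ { (_ , p , tb _) → refl ; (_ , p , bb _) → refl })

sumBelow : ℕ → (ℕ → ℕ) → ℕ
sumBelow zero    c = 0
sumBelow (suc N) c = c 0 ℕ.+ sumBelow N (c ∘ suc)

+-sumBelow : ∀ n c → + sumBelow (suc n) c ≡ Σ≤ n (λ j → + c j)
+-sumBelow zero    c = ℤP.+-identityʳ (+ c 0)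
+-sumBelow (suc n) c = begin
  + (c 0 ℕ.+ sumBelow (suc n) (c ∘ suc))   ≡⟨ ℤP.pos-+ (c 0) _ ⟩
  + c 0 + + sumBelow (suc n) (c ∘ suc)     ≡⟨ cong (_+_ (+ c 0)) (+-sumBelow n (c ∘ suc)) ⟩
  + c 0 + Σ≤ n (λ j → + c (suc j))         ≡⟨ sym (Σ≤-suc n (λ j → + c j)) ⟩
  Σ≤ (suc n) (λ j → + c j)                 ∎
  where open ≡-Reasoning

sumBelow-↔ : ∀ N (P : ℕ → Set) c → (∀ j → N ≤ j → ¬ P j) → (∀ j → Fin (c j) ↔ P j) →
             Fin (sumBelow N c) ↔ Σ ℕ P
sumBelow-↔ zero P c empty _ = mk↔ₛ′ (λ ()) (λ (j , p) → ⊥-elim (empty j z≤n p))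
                                     (λ (j , p) → ⊥-elim (empty j z≤n p)) (λ ())
sumBelow-↔ (suc N) P c empty card = ↔-trans +↔⊎ (↔-trans (card 0 ⊎-↔ rest) split)
  where
  rest : Fin (sumBelow N (c ∘ suc)) ↔ Σ ℕ (P ∘ suc)
  rest = sumBelow-↔ N (P ∘ suc) (c ∘ suc) (λ j N≤j → empty (suc j) (s≤s N≤j)) (card ∘ suc)
  split : (P 0 ⊎ Σ ℕ (P ∘ suc)) ↔ Σ ℕ P
  split = mk↔ₛ′
    (λ { (inj₁ p) → 0 , p ; (inj₂ (j , p)) → suc j , p })
    (λ { (zero , p) → inj₁ p ; (suc j , p) → inj₂ (j , p) })
    (λ { (zero , p) → refl ; (suc j , p) → refl })
    (λ { (inj₁ p) → refl ; (inj₂ (j , p)) → refl })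

-- A walk of length n stays at level ≤ n (walk-level), so the catastrophe edges into T₀ and B₀
-- contribute only from T_{j+1}, B_{j+1} with j ≤ n and the sums are finite.
walkCount : ℕ → V → ℕ
walkCount zero    (T zero)    = 1
walkCount zero    (T (suc i)) = 0
walkCount zero    (B i)       = 0
walkCount (suc n) (T zero)    = sumBelow (suc n) (λ j → walkCount n (T (suc j)))
walkCount (suc n) (T (suc i)) = walkCount n (B i) ℕ.+ walkCount n (T (suc (suc i)))
walkCount (suc n) (B zero)    = walkCount n (T 0) ℕ.+ sumBelow (suc n) (λ j → walkCount n (B (suc j)))
walkCount (suc n) (B (suc i)) = walkCount n (T (suc i)) ℕ.+ walkCount n (B (suc (suc i)))

unreachable : ∀ {n} v → n < level v → ¬ Walk n (T 0) v
unreachable v n<level p = ℕP.<⇒≱ n<level (walk-level p)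

walkCount-↔ : ∀ n v → Fin (walkCount n v) ↔ Walk n (T 0) v
walkCount-↔ zero    (T zero)    =
  mk↔ₛ′ (λ _ → []) (λ _ → Fin.zero) (λ { [] → refl }) (λ { Fin.zero → refl ; (Fin.suc ()) })
walkCount-↔ zero    (T (suc i)) = mk↔ₛ′ (λ ()) (λ ()) (λ ()) (λ ())
walkCount-↔ zero    (B i)       = mk↔ₛ′ (λ ()) (λ ()) (λ ()) (λ ())
walkCount-↔ (suc n) (T zero)    =
  ↔-trans (sumBelow-↔ (suc n) _ _ (λ j n<j → unreachable (T (suc j)) (ℕP.m≤n⇒m≤1+n n<j))
                                  (λ j → walkCount-↔ n (T (suc j))))
          (↔-sym (↔-trans walk-suc-↔ last-into-T₀))
walkCount-↔ (suc n) (T (suc i)) =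
  ↔-trans +↔⊎ (↔-trans (walkCount-↔ n (B i) ⊎-↔ walkCount-↔ n (T (suc (suc i))))
                       (↔-sym (↔-trans walk-suc-↔ (last-into-T i))))
walkCount-↔ (suc n) (B zero)    =
  ↔-trans +↔⊎ (↔-trans (walkCount-↔ n (T 0) ⊎-↔
                          sumBelow-↔ (suc n) _ _ (λ j n<j → unreachable (B (suc j)) (ℕP.m≤n⇒m≤1+n n<j))
                                                 (λ j → walkCount-↔ n (B (suc j))))
                       (↔-sym (↔-trans walk-suc-↔ last-into-B₀)))
walkCount-↔ (suc n) (B (suc i)) =
  ↔-trans +↔⊎ (↔-trans (walkCount-↔ n (T (suc i)) ⊎-↔ walkCount-↔ n (B (suc (suc i))))
                       (↔-sym (↔-trans walk-suc-↔ (last-into-B i))))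

record WalkRecurrence (c : V → FPS) : Set where
  field
    start-T₀ : c (T 0) 0 ≡ + 1
    start-T  : ∀ i → c (T (suc i)) 0 ≡ + 0
    start-B  : ∀ i → c (B i) 0 ≡ + 0
    step-T₀  : ∀ n → c (T 0) (suc n) ≡ Σ≤ n (λ j → c (T (suc j)) n)
    step-T   : ∀ i n → c (T (suc i)) (suc n) ≡ c (B i) n + c (T (suc (suc i))) n
    step-B₀  : ∀ n → c (B 0) (suc n) ≡ c (T 0) n + Σ≤ n (λ j → c (B (suc j)) n)
    step-B   : ∀ i n → c (B (suc i)) (suc n) ≡ c (T (suc i)) n + c (B (suc (suc i))) n

module _ {c : V → FPS} (rec : WalkRecurrence c) where
  open WalkRecurrence rec
  open ≡-Reasoning

  walkCount-unique : ∀ n v → + walkCount n v ≡ c v n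
  walkCount-unique zero    (T zero)    = sym start-T₀
  walkCount-unique zero    (T (suc i)) = sym (start-T i)
  walkCount-unique zero    (B i)       = sym (start-B i)
  walkCount-unique (suc n) (T zero)    = begin
    + sumBelow (suc n) (λ j → walkCount n (T (suc j)))  ≡⟨ +-sumBelow n _ ⟩
    Σ≤ n (λ j → + walkCount n (T (suc j)))              ≡⟨ Σ≤-cong′ n (λ j → walkCount-unique n (T (suc j))) ⟩
    Σ≤ n (λ j → c (T (suc j)) n)                        ≡⟨ sym (step-T₀ n) ⟩
    c (T 0) (suc n)                                     ∎
  walkCount-unique (suc n) (T (suc i)) = begin
    + (walkCount n (B i) ℕ.+ walkCount n (T (suc (suc i))))
      ≡⟨ ℤP.pos-+ (walkCount n (B i)) _ ⟩
    + walkCount n (B i) + + walkCount n (T (suc (suc i)))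
      ≡⟨ cong₂ _+_ (walkCount-unique n (B i)) (walkCount-unique n (T (suc (suc i)))) ⟩
    c (B i) n + c (T (suc (suc i))) n
      ≡⟨ sym (step-T i n) ⟩
    c (T (suc i)) (suc n)
      ∎
  walkCount-unique (suc n) (B zero)    = begin
    + (walkCount n (T 0) ℕ.+ sumBelow (suc n) (λ j → walkCount n (B (suc j))))
      ≡⟨ ℤP.pos-+ (walkCount n (T 0)) _ ⟩
    + walkCount n (T 0) + + sumBelow (suc n) (λ j → walkCount n (B (suc j)))
      ≡⟨ cong₂ _+_ (walkCount-unique n (T 0)) (+-sumBelow n _) ⟩
    c (T 0) n + Σ≤ n (λ j → + walkCount n (B (suc j)))
      ≡⟨ cong (_+_ (c (T 0) n)) (Σ≤-cong′ n (λ j → walkCount-unique n (B (suc j)))) ⟩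
    c (T 0) n + Σ≤ n (λ j → c (B (suc j)) n)
      ≡⟨ sym (step-B₀ n) ⟩
    c (B 0) (suc n)
      ∎
  walkCount-unique (suc n) (B (suc i)) = begin
    + (walkCount n (T (suc i)) ℕ.+ walkCount n (B (suc (suc i))))
      ≡⟨ ℤP.pos-+ (walkCount n (T (suc i))) _ ⟩
    + walkCount n (T (suc i)) + + walkCount n (B (suc (suc i)))
      ≡⟨ cong₂ _+_ (walkCount-unique n (T (suc i))) (walkCount-unique n (B (suc (suc i)))) ⟩
    c (T (suc i)) n + c (B (suc (suc i))) n
      ≡⟨ sym (step-B i n) ⟩
    c (B (suc i)) (suc n)
      ∎

walk-counting-series : ∀ {c} → WalkRecurrence c → ∀ v {a : ℕ → ℕ} →
                       (∀ n → Fin (a n) ↔ Walk n (T 0) v) → ser a ≐ c v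
walk-counting-series rec v a↔ n =
  trans (cong +_ (↔⇒≡ (↔-trans (a↔ n) (↔-sym (walkCount-↔ n v))))) (walkCount-unique rec n v)

-- The generating functions

denominator : FPS → FPS
denominator t = X ⊖ t ⊖ const (+ 2) ⊛ X ⊛ t ⊕ X ⊛ t ⊛ t

denominator-cong : ∀ {a b} → a ≐ b → denominator a ≐ denominator b
denominator-cong {a} {b} a≐b =
  ⊕-cong (⊖-cong (⊖-congˡ X a≐b) (⊛-congˡ (const (+ 2) ⊛ X) a≐b)) (⊛-cong (⊛-congˡ X a≐b) a≐b)

-- τ is t rewritten as X³s and q = X²s = τ/X: in this form the ring solver sees every relation
-- between them, and s (1 - τ)² = 1 is the only remaining input.
module WalkSeries (t s : FPS) (t≐X³s : t ≐ X ^^ 3 ⊛ s) (s-inv : s ⊛ ((𝟙 ⊖ t) ⊛ (𝟙 ⊖ t)) ≐ 𝟙) where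

  τ q D W A r : FPS
  τ = X ^^ 3 ⊛ s
  q = X ^^ 2 ⊛ s
  D = 𝟙 ⊖ q ⊖ const (+ 2) ⊛ τ ⊕ τ ⊛ τ
  W = (X ⊖ τ) ⊛ inv D
  A = W ⊛ (𝟙 ⊖ τ) ⊛ X ⊛ s
  r = inv (𝟙 ⊖ q)

  walks : V → FPS
  walks (T zero)    = 𝟙 ⊕ X ⊛ (A ⊛ r)
  walks (T (suc i)) = A ⊛ q ^^ i
  walks (B i)       = W ⊛ q ^^ i

  τ≐t : τ ≐ t
  τ≐t = ≐-sym t≐X³s

  s-inv′ : s ⊛ ((𝟙 ⊖ τ) ⊛ (𝟙 ⊖ τ)) ≐ 𝟙
  s-inv′ = ≐-trans (⊛-congˡ s (⊛-cong (⊖-congˡ 𝟙 τ≐t) (⊖-congˡ 𝟙 τ≐t))) s-inv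

  r-inv : r ⊛ (𝟙 ⊖ q) ≐ 𝟙
  r-inv = inv-inverseˡ (𝟙 ⊖ q) refl

  D⊛W : D ⊛ W ≐ X ⊖ τ
  D⊛W = begin
    D ⊛ ((X ⊖ τ) ⊛ inv D)  ≈⟨ solve 3 (λ d a u → d :* (a :* u) := a :* (u :* d)) (λ _ → refl) D (X ⊖ τ) (inv D) ⟩
    (X ⊖ τ) ⊛ (inv D ⊛ D)  ≈⟨ ⊛-congˡ (X ⊖ τ) (inv-inverseˡ D refl) ⟩
    (X ⊖ τ) ⊛ 𝟙            ≈⟨ ⊛-identityʳ (X ⊖ τ) ⟩
    X ⊖ τ                  ∎
    where open ≐-Reasoning

  A-step : A ≐ X ⊛ (W ⊕ A ⊛ q)
  A-step = begin
    A
      ≈⟨ solve 3 (λ x s w → let x² = x :* (x :* con (+ 1)) ; u = con (+ 1) :- x :* x² :* s in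
                     w :* u :* x :* s
                  := x :* (w :* (s :* (u :* u)) :+ w :* u :* x :* s :* (x² :* s)))
                 (λ _ → refl) X s W ⟩
    X ⊛ (W ⊛ (s ⊛ ((𝟙 ⊖ τ) ⊛ (𝟙 ⊖ τ))) ⊕ A ⊛ q)
      ≈⟨ ⊛-congˡ X (⊕-congʳ (A ⊛ q) (≐-trans (⊛-congˡ W s-inv′) (⊛-identityʳ W))) ⟩
    X ⊛ (W ⊕ A ⊛ q)
      ∎
    where open ≐-Reasoning

  W⊛q-step : W ⊛ q ≐ X ⊛ (A ⊕ W ⊛ q ⊛ q)
  W⊛q-step = solve 3 (λ x s w → let x² = x :* (x :* con (+ 1)) in
                           w :* (x² :* s)
                        := x :* (w :* (con (+ 1) :- x :* x² :* s) :* x :* s :+ w :* (x² :* s) :* (x² :* s)))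
                     (λ _ → refl) X s W

  walks-T-step : ∀ i → walks (T (suc i)) ≐ X ⊛ (walks (B i) ⊕ walks (T (suc (suc i))))
  walks-T-step i = begin
    A ⊛ q ^^ i
      ≈⟨ ⊛-congʳ (q ^^ i) A-step ⟩
    X ⊛ (W ⊕ A ⊛ q) ⊛ q ^^ i
      ≈⟨ solve 5 (λ x w a q qⁱ → x :* (w :+ a :* q) :* qⁱ := x :* (w :* qⁱ :+ a :* (q :* qⁱ)))
                 (λ _ → refl) X W A q (q ^^ i) ⟩
    X ⊛ (W ⊛ q ^^ i ⊕ A ⊛ q ^^ suc i)
      ∎
    where open ≐-Reasoning

  walks-B-step : ∀ i → walks (B (suc i)) ≐ X ⊛ (walks (T (suc i)) ⊕ walks (B (suc (suc i))))
  walks-B-step i = begin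
    W ⊛ (q ⊛ q ^^ i)
      ≈⟨ ≐-sym (⊛-assoc W q (q ^^ i)) ⟩
    W ⊛ q ⊛ q ^^ i
      ≈⟨ ⊛-congʳ (q ^^ i) W⊛q-step ⟩
    X ⊛ (A ⊕ W ⊛ q ⊛ q) ⊛ q ^^ i
      ≈⟨ solve 5 (λ x w a q qⁱ → x :* (a :+ w :* q :* q) :* qⁱ := x :* (a :* qⁱ :+ w :* (q :* (q :* qⁱ))))
                 (λ _ → refl) X W A q (q ^^ i) ⟩
    X ⊛ (A ⊛ q ^^ i ⊕ W ⊛ q ^^ suc (suc i))
      ∎
    where open ≐-Reasoning

  W-step : W ≐ X ⊛ (walks (T 0) ⊕ W ⊛ q ⊛ r)
  W-step = ⊛-cancelˡ {r} {𝟙 ⊖ q} r-inv (≐-trans lhs (≐-sym rhs))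
    where
    open ≐-Reasoning
    remainder : FPS
    remainder = (X ⊖ τ) ⊕ τ ⊛ (const (+ 2) ⊖ τ) ⊛ W
    lhs : (𝟙 ⊖ q) ⊛ W ≐ remainder
    lhs = begin
      (𝟙 ⊖ q) ⊛ W
        ≈⟨ solve 3 (λ x s w → let x² = x :* (x :* con (+ 1)) ; τ = x :* x² :* s in
                       (con (+ 1) :- x² :* s) :* w
                    := (con (+ 1) :- x² :* s :- con (+ 2) :* τ :+ τ :* τ) :* w :+ τ :* (con (+ 2) :- τ) :* w)
                   (λ _ → refl) X s W ⟩
      D ⊛ W ⊕ τ ⊛ (const (+ 2) ⊖ τ) ⊛ W
        ≈⟨ ⊕-congʳ (τ ⊛ (const (+ 2) ⊖ τ) ⊛ W) D⊛W ⟩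
      remainder
        ∎
    rhs : (𝟙 ⊖ q) ⊛ (X ⊛ (walks (T 0) ⊕ W ⊛ q ⊛ r)) ≐ remainder
    rhs = begin
      (𝟙 ⊖ q) ⊛ (X ⊛ (𝟙 ⊕ X ⊛ (A ⊛ r) ⊕ W ⊛ q ⊛ r))
        ≈⟨ solve 6 (λ x a w q r ι →
                       ι :* (x :* (con (+ 1) :+ x :* (a :* r) :+ w :* q :* r))
                    := x :* ι :+ x :* (x :* a :+ w :* q) :* (r :* ι))
                   (λ _ → refl) X A W q r (𝟙 ⊖ q) ⟩
      X ⊛ (𝟙 ⊖ q) ⊕ X ⊛ (X ⊛ A ⊕ W ⊛ q) ⊛ (r ⊛ (𝟙 ⊖ q))
        ≈⟨ ⊕-congˡ (X ⊛ (𝟙 ⊖ q)) (≐-trans (⊛-congˡ (X ⊛ (X ⊛ A ⊕ W ⊛ q)) r-inv) (⊛-identityʳ _)) ⟩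
      X ⊛ (𝟙 ⊖ q) ⊕ X ⊛ (X ⊛ A ⊕ W ⊛ q)
        ≈⟨ solve 3 (λ x s w → let x² = x :* (x :* con (+ 1)) ; τ = x :* x² :* s in
                       x :* (con (+ 1) :- x² :* s) :+ x :* (x :* (w :* (con (+ 1) :- τ) :* x :* s) :+ w :* (x² :* s))
                    := (x :- τ) :+ τ :* (con (+ 2) :- τ) :* w)
                   (λ _ → refl) X s W ⟩
      remainder
        ∎

  ⊛r-geometric : ∀ b n → (b ⊛ r) n ≡ Σ≤ n (λ j → (b ⊛ q ^^ j) n)
  ⊛r-geometric = ⊛-geometric {q} {X ⊛ s} {r} q≐X⊛Xs r-inv
    where
    q≐X⊛Xs : q ≐ X ⊛ (X ⊛ s)
    q≐X⊛Xs = solve 2 (λ x s → x :* (x :* con (+ 1)) :* s := x :* (x :* s)) (λ _ → refl) X s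

  walks-recurrence : WalkRecurrence walks
  walks-recurrence = record
    { start-T₀ = cong (_+_ (+ 1)) (X⊛-zero (A ⊛ r))
    ; start-T  = λ i → trans (walks-T-step i 0) (X⊛-zero (walks (B i) ⊕ walks (T (suc (suc i)))))
    ; start-B  = λ { zero    → trans (⊛-identityʳ W 0) (trans (W-step 0) (X⊛-zero (walks (T 0) ⊕ W ⊛ q ⊛ r)))
                   ; (suc i) → trans (walks-B-step i 0) (X⊛-zero (walks (T (suc i)) ⊕ walks (B (suc (suc i))))) }
    ; step-T₀  = λ n → trans (ℤP.+-identityˡ ((X ⊛ (A ⊛ r)) (suc n)))
                             (trans (X⊛-suc (A ⊛ r) n) (⊛r-geometric A n))
    ; step-T   = λ i n → trans (walks-T-step i (suc n)) (X⊛-suc (walks (B i) ⊕ walks (T (suc (suc i)))) n)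
    ; step-B₀  = step-B₀
    ; step-B   = λ i n → trans (walks-B-step i (suc n)) (X⊛-suc (walks (T (suc i)) ⊕ walks (B (suc (suc i)))) n)
    }
    where
    open ≡-Reasoning
    step-B₀ : ∀ n → walks (B 0) (suc n) ≡ walks (T 0) n + Σ≤ n (λ j → walks (B (suc j)) n)
    step-B₀ n = begin
      (W ⊛ 𝟙) (suc n)                                     ≡⟨ ⊛-identityʳ W (suc n) ⟩
      W (suc n)                                           ≡⟨ W-step (suc n) ⟩
      (X ⊛ (walks (T 0) ⊕ W ⊛ q ⊛ r)) (suc n)             ≡⟨ X⊛-suc (walks (T 0) ⊕ W ⊛ q ⊛ r) n ⟩
      walks (T 0) n + (W ⊛ q ⊛ r) n                       ≡⟨ cong (_+_ (walks (T 0) n)) (⊛r-geometric (W ⊛ q) n) ⟩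
      walks (T 0) n + Σ≤ n (λ j → (W ⊛ q ⊛ q ^^ j) n)     ≡⟨ cong (_+_ (walks (T 0) n)) (Σ≤-cong′ n (λ j → ⊛-assoc W q (q ^^ j) n)) ⟩
      walks (T 0) n + Σ≤ n (λ j → (W ⊛ q ^^ suc j) n)     ∎

  q⊛X≐τ : q ⊛ X ≐ τ
  q⊛X≐τ = solve 2 (λ x s → x :* (x :* con (+ 1)) :* s :* x := x :* (x :* (x :* con (+ 1))) :* s) (λ _ → refl) X s

  q^^⊛X^^ : ∀ k → q ^^ k ⊛ X ^^ k ≐ τ ^^ k
  q^^⊛X^^ k = ≐-trans (≐-sym (^^-⊛-distrib q X k)) (^^-cong k q⊛X≐τ)

  denominator≐X⊛D : denominator t ≐ X ⊛ D
  denominator≐X⊛D = ≐-trans (denominator-cong t≐X³s)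
    (solve 2 (λ x s → let x² = x :* (x :* con (+ 1)) ; τ = x :* x² :* s in
                   x :- τ :- con (+ 2) :* x :* τ :+ x :* τ :* τ
                := x :* (con (+ 1) :- x² :* s :- con (+ 2) :* τ :+ τ :* τ))
             (λ _ → refl) X s)

  walks-T-closed : ∀ k → walks (T (suc k)) ⊛ denominator t ⊛ X ^^ suc k ≐ (X ⊖ t) ⊛ (𝟙 ⊖ t) ⊛ t ^^ suc k
  walks-T-closed k = begin
    A ⊛ q ^^ k ⊛ denominator t ⊛ X ^^ suc k
      ≈⟨ ⊛-congʳ (X ^^ suc k) (⊛-congˡ (A ⊛ q ^^ k) denominator≐X⊛D) ⟩
    A ⊛ q ^^ k ⊛ (X ⊛ D) ⊛ (X ⊛ X ^^ k)
      ≈⟨ solve 7 (λ x s w u d qᵏ xᵏ →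
                     w :* u :* x :* s :* qᵏ :* (x :* d) :* (x :* xᵏ)
                  := d :* w :* u :* (x :* (x :* (x :* con (+ 1))) :* s) :* (qᵏ :* xᵏ))
                 (λ _ → refl) X s W (𝟙 ⊖ τ) D (q ^^ k) (X ^^ k) ⟩
    D ⊛ W ⊛ (𝟙 ⊖ τ) ⊛ τ ⊛ (q ^^ k ⊛ X ^^ k)
      ≈⟨ ⊛-cong (⊛-congʳ τ (⊛-congʳ (𝟙 ⊖ τ) D⊛W)) (q^^⊛X^^ k) ⟩
    (X ⊖ τ) ⊛ (𝟙 ⊖ τ) ⊛ τ ⊛ τ ^^ k
      ≈⟨ ⊛-assoc ((X ⊖ τ) ⊛ (𝟙 ⊖ τ)) τ (τ ^^ k) ⟩
    (X ⊖ τ) ⊛ (𝟙 ⊖ τ) ⊛ τ ^^ suc k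
      ≈⟨ ⊛-cong (⊛-cong (⊖-congˡ X τ≐t) (⊖-congˡ 𝟙 τ≐t)) (^^-cong (suc k) τ≐t) ⟩
    (X ⊖ t) ⊛ (𝟙 ⊖ t) ⊛ t ^^ suc k
      ∎
    where open ≐-Reasoning

  walks-B-closed : ∀ k → walks (B (suc k)) ⊛ denominator t ⊛ X ^^ k ≐ t ⊛ (X ⊖ t) ⊛ t ^^ k
  walks-B-closed k = begin
    W ⊛ (q ⊛ q ^^ k) ⊛ denominator t ⊛ X ^^ k
      ≈⟨ ⊛-congʳ (X ^^ k) (⊛-congˡ (W ⊛ (q ⊛ q ^^ k)) denominator≐X⊛D) ⟩
    W ⊛ (q ⊛ q ^^ k) ⊛ (X ⊛ D) ⊛ X ^^ k
      ≈⟨ solve 6 (λ w q qᵏ x d xᵏ → w :* (q :* qᵏ) :* (x :* d) :* xᵏ := (q :* x) :* (d :* w) :* (qᵏ :* xᵏ))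
                 (λ _ → refl) W q (q ^^ k) X D (X ^^ k) ⟩
    (q ⊛ X) ⊛ (D ⊛ W) ⊛ (q ^^ k ⊛ X ^^ k)
      ≈⟨ ⊛-cong (⊛-cong q⊛X≐τ D⊛W) (q^^⊛X^^ k) ⟩
    τ ⊛ (X ⊖ τ) ⊛ τ ^^ k
      ≈⟨ ⊛-cong (⊛-cong τ≐t (⊖-congˡ X τ≐t)) (^^-cong k τ≐t) ⟩
    t ⊛ (X ⊖ t) ⊛ t ^^ k
      ∎
    where open ≐-Reasoning

mainTheorem2 :
    (t : FPS) → t 0 ≡ + 0 → t ⊛ (𝟙 ⊖ t) ⊛ (𝟙 ⊖ t) ≐ X ^^ 3 →
    (f g : ℕ → ℕ → ℕ) →
    (∀ i n → Fin (f i n) ↔ Walk n (T 0) (T i)) →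
    (∀ i n → Fin (g i n) ↔ Walk n (T 0) (B i)) →
    ∀ k →
      (ser (f (suc k)) ⊛ (X ⊖ t ⊖ const (+ 2) ⊛ X ⊛ t ⊕ X ⊛ t ⊛ t) ⊛ X ^^ suc k
        ≐ (X ⊖ t) ⊛ (𝟙 ⊖ t) ⊛ t ^^ suc k)
      × (ser (g (suc k)) ⊛ (X ⊖ t ⊖ const (+ 2) ⊛ X ⊛ t ⊕ X ⊛ t ⊛ t) ⊛ X ^^ k
        ≐ t ⊛ (X ⊖ t) ⊛ t ^^ k)
mainTheorem2 t t₀≡0 cubic f g f↔ g↔ k =
    ≐-trans (⊛-congʳ (X ^^ suc k) (⊛-congʳ (denominator t) (ser≐walks (T (suc k)) (f↔ (suc k)))))
            (walks-T-closed k)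
  , ≐-trans (⊛-congʳ (X ^^ k) (⊛-congʳ (denominator t) (ser≐walks (B (suc k)) (g↔ (suc k)))))
            (walks-B-closed k)
  where
  t-factors : (t ≐ X ^^ 3 ⊛ shiftⁿ 3 t) × (shiftⁿ 3 t ⊛ ((𝟙 ⊖ t) ⊛ (𝟙 ⊖ t)) ≐ 𝟙)
  t-factors = X^^-factor ((𝟙 ⊖ t) ⊛ (𝟙 ⊖ t)) (cong (λ c → (+ 1 - c) * (+ 1 - c)) t₀≡0) 3 t
                         (≐-trans (≐-sym (⊛-assoc t (𝟙 ⊖ t) (𝟙 ⊖ t))) cubic)
  open WalkSeries t (shiftⁿ 3 t) (proj₁ t-factors) (proj₂ t-factors)
  ser≐walks : ∀ v {a : ℕ → ℕ} → (∀ n → Fin (a n) ↔ Walk n (T 0) v) → ser a ≐ walks v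
  ser≐walks = walk-counting-series walks-recurrence
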